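{- Let $m\ge1$ and let $w=w_1\otimes\cdots\otimes w_{m+1}$ be a word with letters $w_i\in\{X,Y,Z\}$ such that: (1) $w$ contains at least one $Y$; (2) $w_1\in\{X,Y\}$; (3) $w_{m+1}\in\{X,Y\}$; (4) the first letter of $w$ different from $X$ is $Y$ and the last letter of $w$ different from $X$ is $Y$ (i.e. $w$ begins with $k\ge0$ copies of $X$ followed by $Y$ and ends with $Y$ followed by $\ell\ge0$ copies of $X$); (5) the letters $Y$ and $Z$ alternate in $w$ (between any two occurrences of $Y$ there is a $Z$, and between any two occurrences of $Z$ there is a $Y$). Then $w$ is a term of $Y\cdot P^m\cdot Y\in B^{\otimes(m+1)}$, i.e. its coefficient is nonzero.
   Context: Let $\mathcal M=\mathbb Z\langle y,n\rangle/(yn=ny=n,\ n^2=0,\ y^2=y)$. In the ring $\mathcal M\otimes\mathcal M$ (tensor over $\mathbb Z$, with $(a\otimes b)(c\otimes d)=ac\otimes bd$) put $X=y\otimes n+n\otimes y$, $Y=y\otimes y$, $Z=n\otimes n$, and let $B$ be the $\mathbb Z$-span of $X,Y,Z$: a commutative subring, free abelian with basis $X,Y,Z$, with $X^2=2Z$, $Y^2=Y$, $Z^2=0$, $XY=YX=X$, $XZ=ZX=0$, $YZ=ZY=Z$. For $r\ge1$, $B^{\otimes r}$ is free abelian with basis the words $w_1\otimes\cdots\otimes w_r$, $w_i\in\{X,Y,Z\}$; writing $u\in B^{\otimes r}$ uniquely as $\sum_w c_w w$, a term of $u$ is a word $w$ with $c_w\ne0$, and $c_w$ is its coefficient. The chaining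 product $B^{\otimes r}\times B^{\otimes s}\to B^{\otimes(r+s-1)}$ is the bilinear (associative) map $(a_1\otimes\cdots\otimes a_r)\cdot(b_1\otimes\cdots\otimes b_s)=a_1\otimes\cdots\otimes a_{r-1}\otimes(a_rb_1)\otimes b_2\otimes\cdots\otimes b_s$. Elements of $B$ are regarded as elements of $B^{\otimes1}$. Let $P=X\otimes Y+Y\otimes X\in B^{\otimes2}$ and let $P^m\in B^{\otimes(m+1)}$ be its $m$-fold chaining product. -}

module Defs where

open import Data.Nat using (ℕ; zero; suc; _+_; _<_)
open import Data.Integer using (ℤ; +_; _*_) renaming (_+_ to _+ℤ_)
open import Data.Fin using (Fin)
open import Data.Vec using (Vec; []; _∷_; toList)
open import Data.List using (List; []; _∷_; _++_; concatMap)
open import Data.Maybe using (Maybe; just; nothing)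
open import Data.Product using (_×_; _,_)
open import Relation.Binary.PropositionalEquality using (_≡_; refl)
open import Relation.Nullary using (Dec; yes; no)

-- Basis letters of B = ℤ-span{X,Y,Z}
data L : Set where
  X Y Z : L

_≟L_ : (a b : L) → Dec (a ≡ b)
X ≟L X = yes refl
X ≟L Y = no (λ ())
X ≟L Z = no (λ ())
Y ≟L X = no (λ ())
Y ≟L Y = yes refl
Y ≟L Z = no (λ ())
Z ≟L X = no (λ ())
Z ≟L Y = no (λ ())
Z ≟L Z = yes refl

_≟W_ : (u v : List L) → Dec (u ≡ v)
[] ≟W [] = yes refl
[] ≟W (_ ∷ _) = no (λ ())
(_ ∷ _) ≟W [] = no (λ ())
(a ∷ u) ≟W (b ∷ v) with a ≟L b | u ≟W v
... | yes refl | yes refl = yes refl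
... | no a≢b | _ = no (λ { refl → a≢b refl })
... | yes _ | no u≢v = no (λ { refl → u≢v refl })

-- Multiplication table of B on basis letters: a·b = c·l  (just (c , l)) or 0 (nothing)
-- X²=2Z, Y²=Y, Z²=0, XY=YX=X, XZ=ZX=0, YZ=ZY=Z
mulL : L → L → Maybe (ℤ × L)
mulL X X = just (+ 2 , Z)
mulL X Y = just (+ 1 , X)
mulL X Z = nothing
mulL Y X = just (+ 1 , X)
mulL Y Y = just (+ 1 , Y)
mulL Y Z = just (+ 1 , Z)
mulL Z X = nothing
mulL Z Y = just (+ 1 , Z)
mulL Z Z = nothing

-- Words of length n = basis elements w₁ ⊗ ⋯ ⊗ wₙ of B^{⊗n}
Word : ℕ → Set
Word n = Vec L n

-- Elements of B^{⊗n}, as finite formal ℤ-linear combinations of words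
Tensor : ℕ → Set
Tensor n = List (ℤ × Word n)

chainW : ∀ {r s} → Word (suc r) → Word (suc s) → Maybe (ℤ × Word (suc (r + s)))
chainW {zero} (a ∷ []) (b ∷ bs) with mulL a b
... | nothing = nothing
... | just (c , l) = just (c , l ∷ bs)
chainW {suc r} (a ∷ as) b with chainW {r} as b
... | nothing = nothing
... | just (c , v) = just (c , a ∷ v)

chain : ∀ {r s} → Tensor (suc r) → Tensor (suc s) → Tensor (suc (r + s))
chain u v = concatMap (λ { (c , a) → concatMap (λ { (d , b) → term c d (chainW a b) }) v }) u
  where
  term : ∀ {n} → ℤ → ℤ → Maybe (ℤ × Word n) → Tensor n
  term c d nothing = []
  term c d (just (e , w)) = (c * d * e , w) ∷ []

letter : L → Tensor 1
letter l = (+ 1 , l ∷ []) ∷ []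

P : Tensor 2
P = (+ 1 , X ∷ Y ∷ []) ∷ (+ 1 , Y ∷ X ∷ []) ∷ []

-- P^m ∈ B^{⊗(m+1)} for m ≥ 1 (indexed by k with m = k+1); P^{k+2} = P · P^{k+1}
Ppow : (k : ℕ) → Tensor (suc (suc k))
Ppow zero = P
Ppow (suc k) = chain {1} P (Ppow k)

YPY : (k : ℕ) → Tensor (suc (suc k + 0))
YPY k = chain {suc k} {0} (chain {0} (letter Y) (Ppow k)) (letter Y)

-- Words are compared as lists of letters (lengths agree up to propositional equality).
coeff : ∀ {n k} → Word n → Tensor k → ℤ
coeff w [] = + 0
coeff w ((c , v) ∷ u) with toList w ≟W toList v
... | yes _ = c +ℤ coeff w u
... | no _ = coeff w u

-- Every structure constant of B (X² = 2Z, XY = X, Y² = Y, YZ = Z, ...) is nonnegative, so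
-- no cancellation can occur in Y · Pᵐ · Y: a word has nonzero coefficient as soon as it is
-- produced by one choice of summands of the factors P = X ⊗ Y + Y ⊗ X. Since Y is the unit
-- of B, the words so produced are exactly those of Pᵐ, and chaining one more P in front
-- shows by induction on m that these are the words whose non-X letters read Y Z Y ⋯ Z Y.
-- Conditions (1), (4) and (5) force exactly this pattern, as one checks by reading the word
-- from the left with a two-state automaton.
module Submission where

open import Defs
open import Data.Nat using (ℕ; suc; z≤n; s≤s; z<s)
open import Data.Integer using (ℤ; +_; 0ℤ; _*_; +≤+; +<+) renaming (_≤_ to _≤ℤ_; _<_ to _<ℤ_)
open import Data.Integer.Properties using (<⇒≤; <⇒≢; +-mono-≤; +-mono-<-≤; +-mono-≤-<)
open import Data.Fin using (zero; suc; _<_)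
open import Data.Vec using ([]; _∷_; lookup; last; toList)
open import Data.List using ([]; _∷_)
open import Data.List.Membership.Propositional using (_∈_)
open import Data.List.Relation.Unary.Any using (here; there)
import Data.List.Relation.Unary.Any.Properties as Any
import Data.List.Relation.Unary.All.Properties as All
open import Data.List.Properties using (++-identityʳ)
open import Data.List.Relation.Unary.All using (All; []; _∷_)
open import Data.Maybe using (just; nothing)
import Data.Maybe.Relation.Unary.All as Maybe
open import Data.Product using (_×_; _,_; proj₁; ∃-syntax)
open import Data.Sum using (_⊎_)
open import Data.Unit using (⊤)
open import Data.Empty using (⊥; ⊥-elim)
open import Function using (_∘_; case_of_)
open import Relation.Nullary using (¬_; yes; no)
open import Relation.Binary.PropositionalEquality using (_≡_; _≢_; refl; sym; trans; subst; cong)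

*-positive : ∀ {i j} → 0ℤ <ℤ i → 0ℤ <ℤ j → 0ℤ <ℤ i * j
*-positive (+<+ z<s) (+<+ z<s) = +<+ z<s

PositiveCoeff : {A : Set} → ℤ × A → Set
PositiveCoeff = (0ℤ <ℤ_) ∘ proj₁

PositiveCoeffs : ∀ {n} → Tensor n → Set
PositiveCoeffs = All PositiveCoeff

mulL-positive : ∀ a b → Maybe.All PositiveCoeff (mulL a b)
mulL-positive X X = Maybe.just (+<+ z<s)
mulL-positive X Y = Maybe.just (+<+ z<s)
mulL-positive X Z = Maybe.nothing
mulL-positive Y X = Maybe.just (+<+ z<s)
mulL-positive Y Y = Maybe.just (+<+ z<s)
mulL-positive Y Z = Maybe.just (+<+ z<s)
mulL-positive Z X = Maybe.nothing
mulL-positive Z Y = Maybe.just (+<+ z<s)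
mulL-positive Z Z = Maybe.nothing

chainW-positive : ∀ {r s} (a : Word (suc r)) (b : Word (suc s)) →
                  Maybe.All PositiveCoeff (chainW a b)
chainW-positive {0} (a ∷ []) (b ∷ bs) with mulL a b | mulL-positive a b
... | nothing | _ = Maybe.nothing
... | just _  | Maybe.just p = Maybe.just p
chainW-positive {suc r} (a ∷ as) b with chainW as b | chainW-positive as b
... | nothing | _ = Maybe.nothing
... | just _  | Maybe.just p = Maybe.just p

-- chain ((c , a) ∷ u) v unfolds to the row chain ((c , a) ∷ []) v, without its final ++ [],
-- followed by chain u v.
row-positive : ∀ {r s} {v : Tensor (suc s)} {c} {a : Word (suc r)} →
               0ℤ <ℤ c → PositiveCoeffs v → PositiveCoeffs (chain ((c , a) ∷ []) v)
row-positive pc [] = []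
row-positive {v = (_ , b) ∷ _} {a = a} pc (pd ∷ pv) with chainW a b | chainW-positive a b
... | nothing | _ = row-positive pc pv
... | just _  | Maybe.just pe = *-positive (*-positive pc pd) pe ∷ row-positive pc pv

chain-positive : ∀ {r s} {u : Tensor (suc r)} {v : Tensor (suc s)} →
                 PositiveCoeffs u → PositiveCoeffs v → PositiveCoeffs (chain u v)
chain-positive [] _ = []
chain-positive (pc ∷ pu) pv = All.++⁺ (All.++⁻ˡ _ (row-positive pc pv)) (chain-positive pu pv)

∈-row : ∀ {r s} {v : Tensor (suc s)} {c d e} {a : Word (suc r)} {b x} →
        (d , b) ∈ v → chainW a b ≡ just (e , x) → (c * d * e , x) ∈ chain ((c , a) ∷ []) v
∈-row (here refl) eq rewrite eq = here refl
∈-row {v = (_ , b′) ∷ _} {a = a} (there q) eq with chainW a b′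
... | nothing = ∈-row q eq
... | just _  = there (∈-row q eq)

∈-chain : ∀ {r s} {u : Tensor (suc r)} {v : Tensor (suc s)} {c d e a b x} →
          (c , a) ∈ u → (d , b) ∈ v → chainW a b ≡ just (e , x) → (c * d * e , x) ∈ chain u v
∈-chain (here refl) q eq = Any.++⁺ˡ (subst (_ ∈_) (++-identityʳ _) (∈-row q eq))
∈-chain (there p)   q eq = Any.++⁺ʳ _ (∈-chain p q eq)

coeff-nonnegative : ∀ {m n} (w : Word m) {T : Tensor n} → PositiveCoeffs T → 0ℤ ≤ℤ coeff w T
coeff-nonnegative w [] = +≤+ z≤n
coeff-nonnegative w {(_ , v) ∷ _} (pc ∷ pT) with toList w ≟W toList v
... | yes _ = +-mono-≤ (<⇒≤ pc) (coeff-nonnegative w pT)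
... | no _  = coeff-nonnegative w pT

coeff-positive : ∀ {m n} {w : Word m} {T : Tensor n} {c v} →
                 PositiveCoeffs T → (c , v) ∈ T → toList w ≡ toList v → 0ℤ <ℤ coeff w T
coeff-positive {w = w} {(_ , v) ∷ _} (pc ∷ pT) (here refl) w≡v with toList w ≟W toList v
... | yes _   = +-mono-<-≤ pc (coeff-nonnegative w pT)
... | no w≢v  = ⊥-elim (w≢v w≡v)
coeff-positive {w = w} {(_ , v) ∷ _} (pc ∷ pT) (there p) w≡v with toList w ≟W toList v
... | yes _ = +-mono-≤-< (<⇒≤ pc) (coeff-positive pT p w≡v)
... | no _  = coeff-positive pT p w≡v

mulL-identityˡ : ∀ a → mulL Y a ≡ just (+ 1 , a)
mulL-identityˡ X = refl
mulL-identityˡ Y = refl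
mulL-identityˡ Z = refl

mulL-identityʳ : ∀ a → mulL a Y ≡ just (+ 1 , a)
mulL-identityʳ X = refl
mulL-identityʳ Y = refl
mulL-identityʳ Z = refl

chainW-identityˡ : ∀ {s} (b : Word (suc s)) → chainW (Y ∷ []) b ≡ just (+ 1 , b)
chainW-identityˡ (b ∷ _) rewrite mulL-identityˡ b = refl

chainW-∷ : ∀ {r s} l (a : Word (suc r)) (b : Word (suc s)) {e v} →
           chainW a b ≡ just (e , v) → chainW (l ∷ a) b ≡ just (e , l ∷ v)
chainW-∷ _ _ _ eq rewrite eq = refl

-- a′ has length suc (r + 0), which is not definitionally suc r, so it equals a only as a list.
chainW-identityʳ : ∀ {r} (a : Word (suc r)) →
                   ∃[ a′ ] (chainW a (Y ∷ []) ≡ just (+ 1 , a′) × toList a′ ≡ toList a)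
chainW-identityʳ {0} (a ∷ []) rewrite mulL-identityʳ a = a ∷ [] , refl , refl
chainW-identityʳ {suc r} (l ∷ a) with chainW-identityʳ a
... | a′ , eq , a′≡a = l ∷ a′ , chainW-∷ l a (Y ∷ []) eq , cong (l ∷_) a′≡a

P-positive : PositiveCoeffs P
P-positive = +<+ z<s ∷ +<+ z<s ∷ []

Ppow-positive : ∀ k → PositiveCoeffs (Ppow k)
Ppow-positive 0       = P-positive
Ppow-positive (suc k) = chain-positive P-positive (Ppow-positive k)

letter-positive : ∀ l → PositiveCoeffs (letter l)
letter-positive _ = +<+ z<s ∷ []

YPY-positive : ∀ k → PositiveCoeffs (YPY k)
YPY-positive k =
  chain-positive (chain-positive (letter-positive Y) (Ppow-positive k)) (letter-positive Y)

Term : ∀ {n} → Tensor n → Word n → Set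
Term T w = ∃[ c ] (c , w) ∈ T

coeff-YPY-positive : ∀ {k} {w : Word (suc (suc k))} → Term (Ppow k) w → 0ℤ <ℤ coeff w (YPY k)
coeff-YPY-positive {k} {w} (_ , w∈Pᵏ) with chainW-identityʳ w
... | w′ , wY≡w′ , w′≡w =
  coeff-positive (YPY-positive k)
    (∈-chain {u = chain (letter Y) (Ppow k)} {v = letter Y}
      (∈-chain {u = letter Y} {v = Ppow k} (here refl) w∈Pᵏ (chainW-identityˡ w))
      (here refl) wY≡w′)
    (sym w′≡w)

term-Ppow-suc : ∀ {k c a b e x} → (c , a) ∈ P → Term (Ppow k) b → chainW a b ≡ just (e , x) →
                Term (Ppow (suc k)) x
term-Ppow-suc {k} a∈P (_ , b∈Pᵏ) eq = _ , ∈-chain {u = P} {v = Ppow k} a∈P b∈Pᵏ eq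

data Next : Set where
  nextY nextZ : Next

-- With the X's deleted, w reads Y Z Y ⋯ Z Y if Alternating nextY w,
-- and Z Y ⋯ Z Y or nothing if Alternating nextZ w.
Alternating : ∀ {n} → Next → Word n → Set
Alternating nextY []      = ⊥
Alternating nextZ []      = ⊤
Alternating s     (X ∷ w) = Alternating s w
Alternating nextY (Y ∷ w) = Alternating nextZ w
Alternating nextZ (Y ∷ w) = ⊥
Alternating nextY (Z ∷ w) = ⊥
Alternating nextZ (Z ∷ w) = Alternating nextY w

-- (X ⊗ Y) · b = X ⊗ b,  (Y ⊗ X) · (Y ⊗ ⋯) = Y ⊗ X ⊗ ⋯  and  (Y ⊗ X) · (X ⊗ ⋯) = 2 (Y ⊗ Z ⊗ ⋯).
alternating⇒term-Ppow : ∀ k (w : Word (suc (suc k))) → Alternating nextY w → Term (Ppow k) w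
alternating⇒term-Ppow 0       (X ∷ Y ∷ []) _ = _ , here refl
alternating⇒term-Ppow 0       (Y ∷ X ∷ []) _ = _ , there (here refl)
alternating⇒term-Ppow (suc k) (X ∷ w) alt =
  term-Ppow-suc (here refl) (alternating⇒term-Ppow k w alt)
    (chainW-∷ X (Y ∷ []) w (chainW-identityˡ w))
alternating⇒term-Ppow (suc k) (Y ∷ X ∷ w) alt =
  term-Ppow-suc (there (here refl)) (alternating⇒term-Ppow k (Y ∷ w) alt) refl
alternating⇒term-Ppow (suc k) (Y ∷ Z ∷ w) alt =
  term-Ppow-suc (there (here refl)) (alternating⇒term-Ppow k (X ∷ w) alt) refl

module _ {n : ℕ} where

  record FirstNonX (Q : L → Set) (w : Word n) : Set where
    constructor firstNonX
    field
      atFirstNonX : ∀ i → lookup w i ≢ X → (∀ j → j < i → lookup w j ≡ X) → Q (lookup w i)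

  record LastNonX (Q : L → Set) (w : Word n) : Set where
    constructor lastNonX
    field
      atLastNonX : ∀ i → lookup w i ≢ X → (∀ j → i < j → lookup w j ≡ X) → Q (lookup w i)

  record Separated (a b : L) (w : Word n) : Set where
    constructor separated
    field
      between : ∀ i j → i < j → lookup w i ≡ a → lookup w j ≡ a →
                ∃[ l ] (i < l × l < j × lookup w l ≡ b)

  AllX : Word n → Set
  AllX w = ∀ i → lookup w i ≡ X

  -- The hypotheses of the theorem that pass from a word to its suffixes.
  record SuffixConditions (w : Word n) : Set where
    field
      lastY      : LastNonX (_≡ Y) w
      separatedY : Separated Y Z w
      separatedZ : Separated Z Y w

module _ {n : ℕ} {w : Word n} where

  FirstNonX-tail : ∀ {Q} → FirstNonX Q (X ∷ w) → FirstNonX Q w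
  FirstNonX-tail (firstNonX first) = firstNonX λ i wᵢ≢X before → first (suc i) wᵢ≢X λ where
    zero    _         → refl
    (suc j) (s≤s j<i) → before j j<i

  LastNonX-tail : ∀ {a Q} → LastNonX Q (a ∷ w) → LastNonX Q w
  LastNonX-tail (lastNonX last) = lastNonX λ i wᵢ≢X after → last (suc i) wᵢ≢X λ where
    (suc j) (s≤s i<j) → after j i<j

  LastNonX-head : ∀ {a Q} → LastNonX Q (a ∷ w) → a ≢ X → AllX w → Q a
  LastNonX-head (lastNonX last) a≢X allX = last zero a≢X λ where
    (suc j) _ → allX j

  Separated-tail : ∀ {a b c} → Separated b c (a ∷ w) → Separated b c w
  Separated-tail (separated sep) = separated λ i j i<j wᵢ≡b wⱼ≡b →
    case sep (suc i) (suc j) (s≤s i<j) wᵢ≡b wⱼ≡b of λ where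
      (suc l , s≤s i<l , s≤s l<j , wₗ≡c) → l , i<l , l<j , wₗ≡c

  SuffixConditions-tail : ∀ {a} → SuffixConditions (a ∷ w) → SuffixConditions w
  SuffixConditions-tail cond = record
    { lastY      = LastNonX-tail lastY
    ; separatedY = Separated-tail separatedY
    ; separatedZ = Separated-tail separatedZ
    }
    where open SuffixConditions cond

  FirstNonX-after : ∀ {a b} → b ≢ X → Separated a b (a ∷ w) → FirstNonX (_≢ a) w
  FirstNonX-after b≢X (separated sep) = firstNonX λ i _ before wᵢ≡a →
    case sep zero (suc i) z<s refl wᵢ≡a of λ where
      (suc l , _ , s≤s l<i , wₗ≡b) → b≢X (trans (sym wₗ≡b) (before l l<i))

FirstNonX-map : ∀ {n Q R} {w : Word n} →
                (∀ {a} → a ≢ X → Q a → R a) → FirstNonX Q w → FirstNonX R w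
FirstNonX-map f (firstNonX first) = firstNonX λ i wᵢ≢X before → f wᵢ≢X (first i wᵢ≢X before)

AllX-X∷ : ∀ {n} {w : Word n} → AllX w → AllX (X ∷ w)
AllX-X∷ allX zero    = refl
AllX-X∷ allX (suc i) = allX i

≢X∧≢Z⇒≡Y : ∀ {a} → a ≢ X → a ≢ Z → a ≡ Y
≢X∧≢Z⇒≡Y {X} a≢X _ = ⊥-elim (a≢X refl)
≢X∧≢Z⇒≡Y {Y} _   _ = refl
≢X∧≢Z⇒≡Y {Z} _ a≢Z = ⊥-elim (a≢Z refl)

alternating-nextY : ∀ {n} {w : Word n} →
                    SuffixConditions w → FirstNonX (_≡ Y) w → ¬ AllX w → Alternating nextY w
alternating-nextZ : ∀ {n} {w : Word n} →
                    SuffixConditions w → FirstNonX (_≢ Y) w → Alternating nextZ w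

alternating-nextY {w = []}    _    _     notAllX = notAllX λ ()
alternating-nextY {w = X ∷ _} cond first notAllX =
  alternating-nextY (SuffixConditions-tail cond) (FirstNonX-tail first) (notAllX ∘ AllX-X∷)
alternating-nextY {w = Y ∷ _} cond _     _       =
  alternating-nextZ (SuffixConditions-tail cond)
    (FirstNonX-after (λ ()) (SuffixConditions.separatedY cond))
alternating-nextY {w = Z ∷ _} _    (firstNonX first) _ with first zero (λ ()) (λ _ ())
... | ()

alternating-nextZ {w = []}    _    _     = _
alternating-nextZ {w = X ∷ _} cond first =
  alternating-nextZ (SuffixConditions-tail cond) (FirstNonX-tail first)
alternating-nextZ {w = Y ∷ _} _    (firstNonX first) = first zero (λ ()) (λ _ ()) refl
alternating-nextZ {w = Z ∷ w} cond _     =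
  alternating-nextY (SuffixConditions-tail cond)
    (FirstNonX-map ≢X∧≢Z⇒≡Y nextNonXIsNotZ) nextNonXExists
  where
  open SuffixConditions cond
  nextNonXIsNotZ : FirstNonX (_≢ Z) w
  nextNonXIsNotZ = FirstNonX-after (λ ()) separatedZ
  nextNonXExists : ¬ AllX w
  nextNonXExists allX with LastNonX-head lastY (λ ()) allX
  ... | ()

lemma5p9 : (k : ℕ) → (w : Word (suc (suc k)))
    → (∃[ i ] lookup w i ≡ Y)
    → (lookup w zero ≡ X ⊎ lookup w zero ≡ Y)
    → (last w ≡ X ⊎ last w ≡ Y)
    → (∀ i → lookup w i ≢ X → (∀ j → j < i → lookup w j ≡ X) → lookup w i ≡ Y)
    → (∀ i → lookup w i ≢ X → (∀ j → i < j → lookup w j ≡ X) → lookup w i ≡ Y)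
    → (∀ i j → i < j → lookup w i ≡ Y → lookup w j ≡ Y → ∃[ l ] (i < l × l < j × lookup w l ≡ Z))
    → (∀ i j → i < j → lookup w i ≡ Z → lookup w j ≡ Z → ∃[ l ] (i < l × l < j × lookup w l ≡ Y))
    → coeff w (YPY k) ≢ + 0
lemma5p9 k w (i , wᵢ≡Y) _ _ firstNonXIsY lastNonXIsY Ys-separated Zs-separated =
  <⇒≢ (coeff-YPY-positive (alternating⇒term-Ppow k w alternating)) ∘ sym
  where
  conditions : SuffixConditions w
  conditions = record
    { lastY      = lastNonX lastNonXIsY
    ; separatedY = separated Ys-separated
    ; separatedZ = separated Zs-separated
    }

  notAllX : ¬ AllX w
  notAllX allX with trans (sym (allX i)) wᵢ≡Y
  ... | ()

  alternating : Alternating nextY w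
  alternating = alternating-nextY conditions (firstNonX firstNonXIsY) notAllX
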